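{- For any positive integer $g$, \[ t_g \leq F_{g+1} + \sum_{k = 1}^{g-1} \sum_{A \in \mathcal A_k} F_{g - |(A + A)\cap[0, k]| + |A| - k - 1}. \]
   Context: A numerical semigroup is a subset $\Lambda\subset\mathbb{N}_0$ closed under addition, containing $0$, with finite complement in $\mathbb{N}_0$; its multiplicity $m(\Lambda)$ is its smallest nonzero element, its Frobenius number $f(\Lambda)$ is the largest element of $\mathbb{N}_0\setminus\Lambda$, and its genus is $|\mathbb{N}_0\setminus\Lambda|$. $t_g$ denotes the number of numerical semigroups $\Lambda$ of genus $g$ with $f(\Lambda)<3m(\Lambda)$. For integers $a\le b$, $[a,b]=\{a,\dots,b\}$; $A+A=\{a_1+a_2:a_1,a_2\in A\}$. For a positive integer $k$, $\mathcal A_k=\{A\subset[0,k-1]: 0\in A,\ k\notin A+A\}$. $F_n$ are the Fibonacci numbers, $F_1=F_2=1$, $F_{n+2}=F_{n+1}+F_n$, with the convention $F_n=0$ for all $n\le 0$. -}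

module Defs where

open import Data.Nat using (ℕ; zero; suc; _+_; _*_; _∸_; _<_; _≤_; _≡ᵇ_)
open import Data.Integer as ℤ using (ℤ; +_; -[1+_])
open import Data.Bool using (Bool; true; false; _∧_; not; if_then_else_)
open import Data.List using (List; []; _∷_; map; length; upTo; filterᵇ; _++_)
open import Data.Bool.ListAction using (any)
open import Data.Nat.ListAction using (sum)
open import Data.List.Membership.Propositional using (_∈_)
open import Data.List.Relation.Unary.Unique.Propositional using (Unique)
open import Data.Fin using (Fin)
open import Data.Product using (Σ; _×_; ∃; ∃-syntax)
open import Relation.Binary.PropositionalEquality using (_≡_; _≢_)
open import Relation.Nullary using (¬_)
open import Function.Bundles using (_⇔_)

-- Subsets of ℕ₀ are represented by their (Boolean) characteristic
-- functions  Λ : ℕ → Bool  (n ∈ Λ  iff  Λ n ≡ true).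

HasGenus : (ℕ → Bool) → ℕ → Set
HasGenus Λ g =
  Σ (List ℕ) λ gaps →
    Unique gaps × (∀ n → (n ∈ gaps) ⇔ (Λ n ≡ false)) × length gaps ≡ g

record IsNumericalSemigroup (Λ : ℕ → Bool) : Set where
  field
    has-zero : Λ 0 ≡ true
    closed   : ∀ a b → Λ a ≡ true → Λ b ≡ true → Λ (a + b) ≡ true
    finite-complement : ∃[ g ] HasGenus Λ g

IsMultiplicity : (ℕ → Bool) → ℕ → Set
IsMultiplicity Λ m = 0 < m × Λ m ≡ true × (∀ k → 0 < k → k < m → Λ k ≡ false)

IsFrobenius : (ℕ → Bool) → ℕ → Set
IsFrobenius Λ f = Λ f ≡ false × (∀ n → f < n → Λ n ≡ true)

CountedBy-t : ℕ → (ℕ → Bool) → Set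
CountedBy-t g Λ =
  IsNumericalSemigroup Λ × HasGenus Λ g ×
  ∃[ m ] ∃[ f ] (IsMultiplicity Λ m × IsFrobenius Λ f × f < 3 * m)

-- "t_g ≤ N": every family of pairwise distinct semigroups counted by t_g,
-- indexed by Fin k, has k ≤ N.  (Equivalent to |{Λ counted by t_g}| ≤ N.)
t-AtMost : ℕ → ℕ → Set
t-AtMost g N =
  ∀ (k : ℕ) (Λs : Fin k → (ℕ → Bool)) →
    (∀ i → CountedBy-t g (Λs i)) →
    (∀ i j → i ≢ j → ¬ (∀ n → Λs i n ≡ Λs j n)) →
    k ≤ N

-- Fibonacci numbers, F₁ = F₂ = 1, F₀ = 0, and F_n = 0 for n ≤ 0.

fib : ℕ → ℕ
fib zero = 0
fib (suc zero) = 1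
fib (suc (suc n)) = fib (suc n) + fib n

F : ℤ → ℕ
F (+ n) = fib n
F -[1+ n ] = 0

-- Finite sets of naturals as duplicate-free lists.

_∈ᵇ_ : ℕ → List ℕ → Bool
n ∈ᵇ xs = any (n ≡ᵇ_) xs

powerset : List ℕ → List (List ℕ)
powerset [] = [] ∷ []
powerset (x ∷ xs) = map (x ∷_) (powerset xs) ++ powerset xs

inSumset : List ℕ → ℕ → Bool
inSumset A j = any (λ a → any (λ b → (a + b) ≡ᵇ j) A) A

𝒜 : ℕ → List (List ℕ)
𝒜 k = filterᵇ (λ A → (0 ∈ᵇ A) ∧ not (inSumset A k)) (powerset (upTo k))

sumsetCount : List ℕ → ℕ → ℕ
sumsetCount A k = length (filterᵇ (λ j → inSumset A j) (upTo (suc k)))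

term : ℕ → ℕ → List ℕ → ℕ
term g k A =
  F (((+ g ℤ.- + sumsetCount A k) ℤ.+ + length A) ℤ.- + k ℤ.- + 1)

bound : ℕ → ℕ
bound g = fib (suc g) + sum (map (λ k → sum (map (term g k) (𝒜 k))) (map suc (upTo (g ∸ 1))))

-- A numerical semigroup Λ with multiplicity m and f(Λ) < 3m is determined by which of m + i and
-- 2m + i lie in Λ for 0 < i < m.  Record this as a word over {1, 2, 3} whose i-th letter is 1 if
-- m + i ∈ Λ, 2 if only 2m + i ∈ Λ, and 3 otherwise: the letters add up to the genus g, and by
-- closure, positions i, j carrying 1 (position 0 standing for m itself) force i + j not to carry 3.
-- Words without a 3 are compositions of g into parts 1 and 2, of which there are F_{g+1}.  Otherwise
-- let k be the position of the last 3 and A the set of positions below k carrying 1: then 0 ∈ A,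
-- k ∉ A + A, and each position 0 < i < k carries 1 if i ∈ A, 2 if i ∈ (A + A) ∖ A, and 2 or 3
-- otherwise, while the letters after k form a composition into 1s and 2s.  Since
-- F_{n-1} + F_{n-2} = F_n, a free position costs as much as a forced 1, and the words belonging to
-- (k, A) number at most F_{g - |(A+A) ∩ [0,k]| + |A| - k - 1}.
module Submission where

open import Defs
open import Data.Bool using (Bool; true; false; T; _∧_; _∨_; not; if_then_else_)
open import Data.Bool.Properties using (T-≡; T-not-≡; T-∧)
open import Data.Empty using (⊥-elim)
open import Data.Fin using (Fin) renaming (_≟_ to _≟ᶠ_)
open import Data.Fin.Properties using (injective⇒≤)
open import Data.Integer using (ℤ; _⊖_)
import Data.Integer.Properties as ℤᵖ
import Data.Integer.Tactic.RingSolver as ℤ-Solver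
open import Data.List
  using (List; []; _∷_; [_]; _++_; _∷ʳ_; map; concatMap; length; lookup; upTo; applyUpTo;
         filter; filterᵇ)
open import Data.List.Properties
  using (length-map; length-++; map-++; map-∘; map-cong; map-upTo; map-applyUpTo;
         length-applyUpTo; upTo-∷ʳ)
open import Data.List.Membership.Propositional using (_∈_; _∉_; find)
open import Data.List.Membership.Propositional.Properties
  using (∈-map⁺; ∈-map⁻; ∈-++⁺ˡ; ∈-++⁺ʳ; ∈-concat⁺′; ∈-filter⁺; ∈-filter⁻;
         ∈-upTo⁺)
open import Data.List.Membership.Propositional.Properties.WithK using (unique∧set⇒bag)
open import Data.List.Relation.Binary.BagAndSetEquality using (∼bag⇒↭)
open import Data.List.Relation.Binary.Permutation.Propositional.Properties using (↭-length)
open import Data.List.Relation.Binary.Pointwise using (Pointwise; []; _∷_)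
open import Data.List.Relation.Unary.All using (All; []; _∷_)
open import Data.List.Relation.Unary.AllPairs using (_∷_)
open import Data.List.Relation.Unary.Any using (here; there; index)
import Data.List.Relation.Unary.Any as Any
open import Data.List.Relation.Unary.Any.Properties using (any⁺; any⁻; lookup-index)
open import Data.List.Relation.Unary.Unique.Propositional using (Unique)
open import Data.List.Relation.Unary.Unique.Propositional.Properties
  using (Unique[x∷xs]⇒x∉xs; filter⁺; upTo⁺)
open import Data.Nat
  using (ℕ; zero; suc; _+_; _*_; _∸_; _≤_; _≰_; _<_; _≤′_; ≤′-refl; ≤′-step; z≤n; s≤s; _≡ᵇ_; _≤?_)
open import Data.Nat.DivMod using (_/_; _%_; m≡m%n+[m/n]*n; m%n<n)
open import Data.Nat.ListAction using (sum)
open import Data.Nat.ListAction.Properties using (sum-++)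
open import Data.Nat.Properties
open import Data.Nat.Tactic.RingSolver using (solve-∀)
open import Data.Product using (∃-syntax; ∃₂; _×_; _,_; proj₁; proj₂)
open import Data.Sum using (_⊎_; inj₁; inj₂)
open import Function using (_∘_; _∘′_)
open import Function.Bundles using (_⇔_; mk⇔; Equivalence)
open import Relation.Nullary using (¬_; yes; no; contradiction)
open import Relation.Nullary.Decidable using (T?; ⌊_⌋; decidable-stable)
open import Relation.Unary using (Decidable)
open import Relation.Binary.PropositionalEquality hiding ([_])


F-⊖ : ∀ a b → F (a ⊖ b) ≡ fib (a ∸ b)
F-⊖ a zero = refl
F-⊖ zero (suc b) = refl
F-⊖ (suc a) (suc b) rewrite ℤᵖ.[1+m]⊖[1+n]≡m⊖n a b = F-⊖ a b

term-≡-fib : ∀ g k A → term g k A ≡ fib (g + length A ∸ (sumsetCount A k + k + 1))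
term-≡-fib g k A = begin
  F (+ g - + s +ℤ + a - + k - + 1)       ≡⟨ cong F (regroup (+ g) (+ s) (+ a) (+ k)) ⟩
  F (+ g +ℤ + a - (+ s +ℤ + k +ℤ + 1))   ≡⟨ cong₂ (λ x y → F (x - y)) (ℤᵖ.pos-+ g a) +-s+k+1 ⟨
  F (+ (g + a) - + (s + k + 1))          ≡⟨ cong F (ℤᵖ.[+m]-[+n]≡m⊖n (g + a) (s + k + 1)) ⟩
  F ((g + a) ⊖ (s + k + 1))              ≡⟨ F-⊖ (g + a) (s + k + 1) ⟩
  fib (g + a ∸ (s + k + 1))              ∎
  where
  open ≡-Reasoning
  open Data.Integer using (+_; _-_) renaming (_+_ to _+ℤ_)
  s = sumsetCount A k
  a = length A
  regroup : ∀ (g s a k : ℤ) → g - s +ℤ a - k - + 1 ≡ g +ℤ a - (s +ℤ k +ℤ + 1)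
  regroup = ℤ-Solver.solve-∀
  +-s+k+1 : + (s + k + 1) ≡ + s +ℤ + k +ℤ + 1
  +-s+k+1 = trans (ℤᵖ.pos-+ (s + k) 1) (cong (_+ℤ + 1) (ℤᵖ.pos-+ s k))

fib-mono : ∀ {m n} → m ≤ n → fib m ≤ fib n
fib-mono m≤n = go (≤⇒≤′ m≤n)
  where
  fib-suc-mono : ∀ n → fib n ≤ fib (suc n)
  fib-suc-mono zero = z≤n
  fib-suc-mono (suc n) = m≤m+n (fib (suc n)) (fib n)
  go : ∀ {m n} → m ≤′ n → fib m ≤ fib n
  go ≤′-refl = ≤-refl
  go (≤′-step {n} m≤′n) = ≤-trans (go m≤′n) (fib-suc-mono n)

fib-∸-step : ∀ n k → fib (n ∸ suc k) + fib (n ∸ suc (suc k)) ≤ fib (n ∸ k)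
fib-∸-step zero k = z≤n
fib-∸-step (suc zero) zero = z≤n
fib-∸-step (suc (suc n)) zero = ≤-refl
fib-∸-step (suc n) (suc k) = fib-∸-step n k

m∸n≤m+o∸p : ∀ m n o p → p ≤ o + n → m ∸ n ≤ m + o ∸ p
m∸n≤m+o∸p m n o p p≤o+n = begin
  m ∸ n             ≡⟨ [m+n]∸[m+o]≡n∸o o m n ⟨
  o + m ∸ (o + n)   ≤⟨ ∸-monoʳ-≤ (o + m) p≤o+n ⟩
  o + m ∸ p         ≡⟨ cong (_∸ p) (+-comm o m) ⟩
  m + o ∸ p         ∎
  where open ≤-Reasoning

χ : Bool → ℕ
χ true = 1
χ false = 0

countᵇ : {A : Set} → (A → Bool) → List A → ℕ
countᵇ p xs = sum (map (χ ∘ p) xs)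

length-filterᵇ : {A : Set} (p : A → Bool) (xs : List A) → length (filterᵇ p xs) ≡ countᵇ p xs
length-filterᵇ p [] = refl
length-filterᵇ p (x ∷ xs) with p x
... | true = cong suc (length-filterᵇ p xs)
... | false = length-filterᵇ p xs

sum-map-+ : {A : Set} (f g : A → ℕ) (xs : List A) →
            sum (map (λ x → f x + g x) xs) ≡ sum (map f xs) + sum (map g xs)
sum-map-+ f g [] = refl
sum-map-+ f g (x ∷ xs) = trans (cong (f x + g x +_) (sum-map-+ f g xs)) (interchange (f x) (g x) _ _)
  where
  interchange : ∀ a b c d → a + b + (c + d) ≡ a + c + (b + d)
  interchange = solve-∀

sum-map-1 : {A : Set} (xs : List A) → sum (map (λ _ → 1) xs) ≡ length xs
sum-map-1 [] = refl
sum-map-1 (x ∷ xs) = cong suc (sum-map-1 xs)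

sum-map-mono : {A : Set} {f g : A → ℕ} {xs : List A} → (∀ {x} → x ∈ xs → f x ≤ g x) →
               sum (map f xs) ≤ sum (map g xs)
sum-map-mono {xs = []} f≤g = z≤n
sum-map-mono {xs = x ∷ xs} f≤g = +-mono-≤ (f≤g (here refl)) (sum-map-mono (f≤g ∘ there))

countᵇ-∷ʳ : {A : Set} (p : A → Bool) (xs : List A) (x : A) →
            countᵇ p (xs ∷ʳ x) ≡ countᵇ p xs + χ (p x)
countᵇ-∷ʳ p xs x = begin
  sum (map (χ ∘ p) (xs ++ [ x ]))       ≡⟨ cong sum (map-++ (χ ∘ p) xs [ x ]) ⟩
  sum (map (χ ∘ p) xs ++ [ χ (p x) ])   ≡⟨ sum-++ (map (χ ∘ p) xs) [ χ (p x) ] ⟩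
  countᵇ p xs + (χ (p x) + 0)           ≡⟨ cong (countᵇ p xs +_) (+-identityʳ (χ (p x))) ⟩
  countᵇ p xs + χ (p x)                 ∎
  where open ≡-Reasoning

countᵇ-≤-+ : {A : Set} {r : A → Bool} (p q : A → Bool) → (∀ x → χ (r x) ≤ χ (p x) + χ (q x)) →
             ∀ xs → countᵇ r xs ≤ countᵇ p xs + countᵇ q xs
countᵇ-≤-+ p q r≤p+q xs = ≤-trans (sum-map-mono {xs = xs} (λ {x} _ → r≤p+q x))
                                  (≤-reflexive (sum-map-+ (χ ∘ p) (χ ∘ q) xs))

≡ᵇ-true⇒≡ : ∀ {m n} → (m ≡ᵇ n) ≡ true → m ≡ n
≡ᵇ-true⇒≡ {m} {n} m≡ᵇn = ≡ᵇ⇒≡ m n (subst T (sym m≡ᵇn) _)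

countᵇ-≡ᵇ-∉ : ∀ a {xs} → a ∉ xs → countᵇ (_≡ᵇ a) xs ≡ 0
countᵇ-≡ᵇ-∉ a {[]} _ = refl
countᵇ-≡ᵇ-∉ a {x ∷ xs} a∉ with x ≡ᵇ a in x≡ᵇa
... | true = contradiction (here (sym (≡ᵇ-true⇒≡ x≡ᵇa))) a∉
... | false = countᵇ-≡ᵇ-∉ a (a∉ ∘ there)

countᵇ-≡ᵇ-unique : ∀ a {xs} → Unique xs → countᵇ (_≡ᵇ a) xs ≤ 1
countᵇ-≡ᵇ-unique a {[]} _ = z≤n
countᵇ-≡ᵇ-unique a {x ∷ xs} u@(_ ∷ u′) with x ≡ᵇ a in x≡ᵇa
... | false = countᵇ-≡ᵇ-unique a u′
... | true = s≤s (≤-reflexive (countᵇ-≡ᵇ-∉ a a∉xs))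
  where
  a∉xs : a ∉ xs
  a∉xs = subst (_∉ xs) (≡ᵇ-true⇒≡ x≡ᵇa) (Unique[x∷xs]⇒x∉xs u)

countᵇ-∈ᵇ-unique : ∀ A {xs} → Unique xs → countᵇ (_∈ᵇ A) xs ≤ length A
countᵇ-∈ᵇ-unique [] {[]} _ = z≤n
countᵇ-∈ᵇ-unique [] {_ ∷ _} (_ ∷ u) = countᵇ-∈ᵇ-unique [] u
countᵇ-∈ᵇ-unique (a ∷ A) {xs} u = ≤-trans (countᵇ-≤-+ (_≡ᵇ a) (_∈ᵇ A) χ-∨ xs)
                                          (+-mono-≤ (countᵇ-≡ᵇ-unique a u) (countᵇ-∈ᵇ-unique A u))
  where
  χ-∨ : ∀ x → χ ((x ≡ᵇ a) ∨ (x ∈ᵇ A)) ≤ χ (x ≡ᵇ a) + χ (x ∈ᵇ A)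
  χ-∨ x with x ≡ᵇ a
  ... | true = s≤s z≤n
  ... | false = ≤-refl

sum-applyUpTo-+ : ∀ (f : ℕ → ℕ) a b →
                  sum (applyUpTo f (a + b)) ≡ sum (applyUpTo f a) + sum (applyUpTo (λ i → f (a + i)) b)
sum-applyUpTo-+ f zero b = refl
sum-applyUpTo-+ f (suc a) b =
  trans (cong (f 0 +_) (sum-applyUpTo-+ (f ∘ suc) a b)) (sym (+-assoc (f 0) _ _))

sum-applyUpTo-+ᶠ : ∀ (f g : ℕ → ℕ) n →
                   sum (applyUpTo (λ i → f i + g i) n) ≡ sum (applyUpTo f n) + sum (applyUpTo g n)
sum-applyUpTo-+ᶠ f g n = begin
  sum (applyUpTo (λ i → f i + g i) n)          ≡⟨ cong sum (map-upTo (λ i → f i + g i) n) ⟨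
  sum (map (λ i → f i + g i) (upTo n))         ≡⟨ sum-map-+ f g (upTo n) ⟩
  sum (map f (upTo n)) + sum (map g (upTo n))  ≡⟨ cong₂ (λ x y → sum x + sum y) (map-upTo f n) (map-upTo g n) ⟩
  sum (applyUpTo f n) + sum (applyUpTo g n)    ∎
  where open ≡-Reasoning

sum-applyUpTo-cong : ∀ {f g : ℕ → ℕ} n → (∀ {i} → i < n → f i ≡ g i) →
                     sum (applyUpTo f n) ≡ sum (applyUpTo g n)
sum-applyUpTo-cong zero _ = refl
sum-applyUpTo-cong (suc n) f≡g = cong₂ _+_ (f≡g (s≤s z≤n)) (sum-applyUpTo-cong n (f≡g ∘ s≤s))

length-concatMap : {A B : Set} (f : A → List B) (xs : List A) →
                   length (concatMap f xs) ≡ sum (map (length ∘ f) xs)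
length-concatMap f [] = refl
length-concatMap f (x ∷ xs) = trans (length-++ (f x)) (cong (length (f x) +_) (length-concatMap f xs))

unique-⇔-length : {A : Set} {xs ys : List A} → Unique xs → Unique ys → (∀ {x} → x ∈ xs ⇔ x ∈ ys) →
                  length xs ≡ length ys
unique-⇔-length uxs uys same = ↭-length (∼bag⇒↭ (unique∧set⇒bag uxs uys same))

distinct-∈⇒≤-length : {A : Set} {k : ℕ} {xs : List A} (f : Fin k → A) → (∀ i → f i ∈ xs) →
                      (∀ i j → i ≢ j → f i ≢ f j) → k ≤ length xs
distinct-∈⇒≤-length {xs = xs} f f∈xs distinct = injective⇒≤ index-injective
  where
  index-injective : ∀ {i j} → index (f∈xs i) ≡ index (f∈xs j) → i ≡ j
  index-injective {i} {j} same-index = decidable-stable (i ≟ᶠ j) λ i≢j → distinct i j i≢j (begin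
    f i                          ≡⟨ lookup-index (f∈xs i) ⟩
    lookup xs (index (f∈xs i))   ≡⟨ cong (lookup xs) same-index ⟩
    lookup xs (index (f∈xs j))   ≡⟨ lookup-index (f∈xs j) ⟨
    f j                          ∎)
    where open ≡-Reasoning

∈ᵇ⇒∈ : ∀ {i A} → T (i ∈ᵇ A) → i ∈ A
∈ᵇ⇒∈ {i} {A} t = Any.map (≡ᵇ⇒≡ i _) (any⁻ (i ≡ᵇ_) A t)

∈⇒∈ᵇ : ∀ {i A} → i ∈ A → T (i ∈ᵇ A)
∈⇒∈ᵇ {i} i∈A = any⁺ (i ≡ᵇ_) (Any.map (λ { refl → ≡⇒≡ᵇ i i refl }) i∈A)

¬T⇒T-not : ∀ {b} → ¬ T b → T (not b)
¬T⇒T-not {false} _ = _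
¬T⇒T-not {true} ¬t = ¬t _

inSumset⁻ : ∀ A j → T (inSumset A j) → ∃₂ λ a b → a ∈ A × b ∈ A × a + b ≡ j
inSumset⁻ A j t with find (any⁻ _ A t)
... | a , a∈A , t′ with find (any⁻ _ A t′)
...   | b , b∈A , a+b≡ᵇj = a , b , a∈A , b∈A , ≡ᵇ⇒≡ (a + b) j a+b≡ᵇj

filter-∈-powerset : {P : ℕ → Set} (P? : Decidable P) (xs : List ℕ) → filter P? xs ∈ powerset xs
filter-∈-powerset P? [] = here refl
filter-∈-powerset P? (x ∷ xs) with P? x
... | yes _ = ∈-++⁺ˡ (∈-map⁺ (x ∷_) (filter-∈-powerset P? xs))
... | no _ = ∈-++⁺ʳ (map (x ∷_) (powerset xs)) (filter-∈-powerset P? xs)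

data Part : Set where
  ① ② ③ : Part

value : Part → ℕ
value ① = 1
value ② = 2
value ③ = 3

total : List Part → ℕ
total w = sum (map value w)

total-++ : ∀ p c → total (p ++ c) ≡ total p + total c
total-++ p c = trans (cong sum (map-++ value p c)) (sum-++ (map value p) (map value c))

length≤total : ∀ w → length w ≤ total w
length≤total [] = z≤n
length≤total (① ∷ w) = s≤s (length≤total w)
length≤total (② ∷ w) = s≤s (m≤n⇒m≤1+n (length≤total w))
length≤total (③ ∷ w) = s≤s (m≤n⇒m≤o+n 2 (length≤total w))

split-last③ : ∀ w → All (_≢ ③) w ⊎ ∃₂ λ p c → w ≡ p ++ ③ ∷ c × All (_≢ ③) c
split-last③ [] = inj₁ []
split-last③ (d ∷ w) with split-last③ w
... | inj₂ (p , c , refl , no③) = inj₂ (d ∷ p , c , refl , no③)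
split-last③ (① ∷ w) | inj₁ no③ = inj₁ ((λ ()) ∷ no③)
split-last③ (② ∷ w) | inj₁ no③ = inj₁ ((λ ()) ∷ no③)
split-last③ (③ ∷ w) | inj₁ no③ = inj₂ ([] , w , refl , no③)

-- Reading past the end gives the junk value ②.
infixl 9 _‼_
_‼_ : List Part → ℕ → Part
[] ‼ _ = ②
(d ∷ w) ‼ zero = d
(d ∷ w) ‼ suc j = w ‼ j

‼-++ˡ : ∀ p {r} j → j < length p → (p ++ r) ‼ j ≡ p ‼ j
‼-++ˡ (d ∷ p) zero _ = refl
‼-++ˡ (d ∷ p) (suc j) (s≤s j<) = ‼-++ˡ p j j<

‼-length : ∀ p {d r} → (p ++ d ∷ r) ‼ length p ≡ d
‼-length [] = refl
‼-length (_ ∷ p) = ‼-length p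

map-applyUpTo-‼ : ∀ (f : ℕ → Part) g {n j} → j < n → map f (applyUpTo g n) ‼ j ≡ f (g j)
map-applyUpTo-‼ f g {suc n} {zero} _ = refl
map-applyUpTo-‼ f g {suc n} {suc j} (s≤s j<n) = map-applyUpTo-‼ f (g ∘ suc) j<n

map-applyUpTo-‼-≥ : ∀ (f : ℕ → Part) g {n j} → n ≤ j → map f (applyUpTo g n) ‼ j ≡ ②
map-applyUpTo-‼-≥ f g {zero} _ = refl
map-applyUpTo-‼-≥ f g {suc n} {suc j} (s≤s n≤j) = map-applyUpTo-‼-≥ f (g ∘ suc) n≤j

pointwise-‼ : {X : Set} {R : Part → X → Set} (f : ℕ → X) (g : ℕ → ℕ) (p : List Part) →
              (∀ j → j < length p → R (p ‼ j) (f (g j))) →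
              Pointwise R p (map f (applyUpTo g (length p)))
pointwise-‼ f g [] _ = []
pointwise-‼ f g (d ∷ p) R-at =
  R-at 0 (s≤s z≤n) ∷ pointwise-‼ f (g ∘ suc) p (λ j j< → R-at (suc j) (s≤s j<))

compositions₁₂ : ℕ → List (List Part)
compositions₁₂ zero = [ [] ]
compositions₁₂ (suc zero) = [ [ ① ] ]
compositions₁₂ (suc (suc n)) =
  map (① ∷_) (compositions₁₂ (suc n)) ++ map (② ∷_) (compositions₁₂ n)

length-compositions₁₂ : ∀ n → length (compositions₁₂ n) ≡ fib (suc n)
length-compositions₁₂ zero = refl
length-compositions₁₂ (suc zero) = refl
length-compositions₁₂ (suc (suc n)) = begin
  length (map (① ∷_) (compositions₁₂ (suc n)) ++ map (② ∷_) (compositions₁₂ n))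
    ≡⟨ length-++ (map (① ∷_) (compositions₁₂ (suc n))) ⟩
  length (map (① ∷_) (compositions₁₂ (suc n))) + length (map (② ∷_) (compositions₁₂ n))
    ≡⟨ cong₂ _+_ (length-map (① ∷_) (compositions₁₂ (suc n))) (length-map (② ∷_) (compositions₁₂ n)) ⟩
  length (compositions₁₂ (suc n)) + length (compositions₁₂ n)
    ≡⟨ cong₂ _+_ (length-compositions₁₂ (suc n)) (length-compositions₁₂ n) ⟩
  fib (suc (suc n)) + fib (suc n) ∎
  where open ≡-Reasoning

∈-compositions₁₂ : ∀ w → All (_≢ ③) w → w ∈ compositions₁₂ (total w)
∈-compositions₁₂ [] _ = here refl
∈-compositions₁₂ (① ∷ []) _ = here refl
∈-compositions₁₂ (① ∷ w@(① ∷ _)) (_ ∷ no③) = ∈-++⁺ˡ (∈-map⁺ (① ∷_) (∈-compositions₁₂ w no③))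
∈-compositions₁₂ (① ∷ w@(② ∷ _)) (_ ∷ no③) = ∈-++⁺ˡ (∈-map⁺ (① ∷_) (∈-compositions₁₂ w no③))
∈-compositions₁₂ (① ∷ ③ ∷ w) (_ ∷ ③≢③ ∷ _) = contradiction refl ③≢③
∈-compositions₁₂ (② ∷ w) (_ ∷ no③) =
  ∈-++⁺ʳ (map (① ∷_) (compositions₁₂ (suc (total w)))) (∈-map⁺ (② ∷_) (∈-compositions₁₂ w no③))
∈-compositions₁₂ (③ ∷ w) (③≢③ ∷ _) = contradiction refl ③≢③

endings : ℕ → List (List Part)
endings (suc (suc (suc n))) = map (③ ∷_) (compositions₁₂ n)
endings _ = []

length-endings : ∀ n → length (endings n) ≤ fib (n ∸ 2)
length-endings (suc (suc (suc n))) =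
  ≤-reflexive (trans (length-map (③ ∷_) (compositions₁₂ n)) (length-compositions₁₂ n))
length-endings zero = z≤n
length-endings (suc zero) = z≤n
length-endings (suc (suc zero)) = z≤n

data Slot : Set where
  forced① forced② free : Slot

infix 4 _fits_
data _fits_ : Part → Slot → Set where
  ①-forced : ① fits forced①
  ②-forced : ② fits forced②
  ②-free   : ② fits free
  ③-free   : ③ fits free

-- A free slot costs 1 because F_{n-2} + F_{n-3} ≤ F_{n-1}.
cost : Slot → ℕ
cost forced① = 1
cost forced② = 2
cost free = 1

completions : List Slot → ℕ → List (List Part)
completions [] n = endings n
completions (forced① ∷ ss) n = map (① ∷_) (completions ss (n ∸ 1))
completions (forced② ∷ ss) n = map (② ∷_) (completions ss (n ∸ 2))
completions (free ∷ ss) n =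
  map (② ∷_) (completions ss (n ∸ 2)) ++ map (③ ∷_) (completions ss (n ∸ 3))

∈-completions : ∀ {p ss} → Pointwise _fits_ p ss → ∀ c → All (_≢ ③) c →
                p ++ ③ ∷ c ∈ completions ss (total (p ++ ③ ∷ c))
∈-completions [] c no③ = ∈-map⁺ (③ ∷_) (∈-compositions₁₂ c no③)
∈-completions (①-forced ∷ fit) c no③ = ∈-map⁺ (① ∷_) (∈-completions fit c no③)
∈-completions (②-forced ∷ fit) c no③ = ∈-map⁺ (② ∷_) (∈-completions fit c no③)
∈-completions (②-free ∷ fit) c no③ = ∈-++⁺ˡ (∈-map⁺ (② ∷_) (∈-completions fit c no③))
∈-completions {③ ∷ p} {free ∷ ss} (③-free ∷ fit) c no③ =
  ∈-++⁺ʳ (map (② ∷_) (completions ss (total (③ ∷ p ++ ③ ∷ c) ∸ 2)))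
         (∈-map⁺ (③ ∷_) (∈-completions fit c no③))

length-completions : ∀ ss n → length (completions ss n) ≤ fib (n ∸ (2 + sum (map cost ss)))
length-completions [] n = length-endings n
length-completions (forced① ∷ ss) n = begin
  length (map (① ∷_) (completions ss (n ∸ 1)))  ≡⟨ length-map (① ∷_) (completions ss (n ∸ 1)) ⟩
  length (completions ss (n ∸ 1))               ≤⟨ length-completions ss (n ∸ 1) ⟩
  fib (n ∸ 1 ∸ (2 + C))                        ≡⟨ cong fib (∸-+-assoc n 1 (2 + C)) ⟩
  fib (n ∸ (3 + C))                            ∎
  where
  open ≤-Reasoning
  C = sum (map cost ss)
length-completions (forced② ∷ ss) n = begin
  length (map (② ∷_) (completions ss (n ∸ 2)))  ≡⟨ length-map (② ∷_) (completions ss (n ∸ 2)) ⟩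
  length (completions ss (n ∸ 2))               ≤⟨ length-completions ss (n ∸ 2) ⟩
  fib (n ∸ 2 ∸ (2 + C))                        ≡⟨ cong fib (∸-+-assoc n 2 (2 + C)) ⟩
  fib (n ∸ (4 + C))                            ∎
  where
  open ≤-Reasoning
  C = sum (map cost ss)
length-completions (free ∷ ss) n = begin
  length (map (② ∷_) (completions ss (n ∸ 2)) ++ map (③ ∷_) (completions ss (n ∸ 3)))
    ≡⟨ length-++ (map (② ∷_) (completions ss (n ∸ 2))) ⟩
  length (map (② ∷_) (completions ss (n ∸ 2))) + length (map (③ ∷_) (completions ss (n ∸ 3)))
    ≡⟨ cong₂ _+_ (length-map (② ∷_) (completions ss (n ∸ 2))) (length-map (③ ∷_) (completions ss (n ∸ 3))) ⟩
  length (completions ss (n ∸ 2)) + length (completions ss (n ∸ 3))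
    ≤⟨ +-mono-≤ (length-completions ss (n ∸ 2)) (length-completions ss (n ∸ 3)) ⟩
  fib (n ∸ 2 ∸ (2 + C)) + fib (n ∸ 3 ∸ (2 + C))
    ≡⟨ cong₂ _+_ (cong fib (∸-+-assoc n 2 (2 + C))) (cong fib (∸-+-assoc n 3 (2 + C))) ⟩
  fib (n ∸ (4 + C)) + fib (n ∸ (5 + C))
    ≤⟨ fib-∸-step n (3 + C) ⟩
  fib (n ∸ (3 + C)) ∎
  where
  open ≤-Reasoning
  C = sum (map cost ss)

slot : List ℕ → ℕ → Slot
slot A i = if i ∈ᵇ A then forced① else if inSumset A i then forced② else free

slots : List ℕ → ℕ → List Slot
slots A k = map (slot A) (applyUpTo suc (k ∸ 1))

newSum : List ℕ → ℕ → Bool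
newSum A i = not (i ∈ᵇ A) ∧ inSumset A i

cost-slot : ∀ A i → cost (slot A i) ≡ 1 + χ (newSum A i)
cost-slot A i with i ∈ᵇ A | inSumset A i
... | true | _ = refl
... | false | true = refl
... | false | false = refl

χ-inSumset-≤ : ∀ A i → χ (inSumset A i) ≤ χ (i ∈ᵇ A) + χ (newSum A i)
χ-inSumset-≤ A i with i ∈ᵇ A | inSumset A i
... | true | true = ≤-refl
... | true | false = z≤n
... | false | _ = ≤-refl

fits-slot : ∀ A i d → (d ≡ ① → T (i ∈ᵇ A)) → (T (i ∈ᵇ A) → d ≡ ①) →
            (d ≡ ③ → ¬ T (inSumset A i)) → d fits slot A i
fits-slot A i d ①⇒∈ ∈⇒① ③⇒∉ with i ∈ᵇ A | inSumset A i
... | true | _ with refl ← ∈⇒① _ = ①-forced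
fits-slot A i ① ①⇒∈ ∈⇒① ③⇒∉ | false | _ = ⊥-elim (①⇒∈ refl)
fits-slot A i ② ①⇒∈ ∈⇒① ③⇒∉ | false | true = ②-forced
fits-slot A i ② ①⇒∈ ∈⇒① ③⇒∉ | false | false = ②-free
fits-slot A i ③ ①⇒∈ ∈⇒① ③⇒∉ | false | true = ⊥-elim (③⇒∉ refl _)
fits-slot A i ③ ①⇒∈ ∈⇒① ③⇒∉ | false | false = ③-free

total-cost-slots : ∀ A k′ → sum (map cost (slots A (suc k′))) ≡ k′ + countᵇ (newSum A) (applyUpTo suc k′)
total-cost-slots A k′ = begin
  sum (map cost (map (slot A) ps))         ≡⟨ cong sum (map-∘ ps) ⟨
  sum (map (cost ∘ slot A) ps)             ≡⟨ cong sum (map-cong (cost-slot A) ps) ⟩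
  sum (map (λ i → 1 + χ (newSum A i)) ps)  ≡⟨ sum-map-+ (λ _ → 1) (χ ∘ newSum A) ps ⟩
  sum (map (λ _ → 1) ps) + f               ≡⟨ cong (_+ f) (trans (sum-map-1 ps) (length-applyUpTo suc k′)) ⟩
  k′ + f                                   ∎
  where
  open ≡-Reasoning
  ps = applyUpTo suc k′
  f = countᵇ (newSum A) ps

sumsetCount-≤ : ∀ A k′ → T (0 ∈ᵇ A) → T (not (inSumset A (suc k′))) →
                sumsetCount A (suc k′) ≤ length A + countᵇ (newSum A) (applyUpTo suc k′)
sumsetCount-≤ A k′ 0∈A k∉A+A = begin
  sumsetCount A k
    ≡⟨ length-filterᵇ (inSumset A) (upTo (suc k)) ⟩
  countᵇ (inSumset A) (upTo (suc k))
    ≡⟨ cong (countᵇ (inSumset A)) (upTo-∷ʳ k) ⟨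
  countᵇ (inSumset A) (upTo k ∷ʳ k)
    ≡⟨ countᵇ-∷ʳ (inSumset A) (upTo k) k ⟩
  countᵇ (inSumset A) (upTo k) + χ (inSumset A k)
    ≡⟨ cong (λ b → countᵇ (inSumset A) (upTo k) + χ b) (Equivalence.to T-not-≡ k∉A+A) ⟩
  countᵇ (inSumset A) (upTo k) + 0
    ≡⟨ +-identityʳ _ ⟩
  countᵇ (inSumset A) (upTo k)
    ≤⟨ countᵇ-≤-+ (_∈ᵇ A) (newSum A) (χ-inSumset-≤ A) (upTo k) ⟩
  countᵇ (_∈ᵇ A) (upTo k) + (χ (newSum A 0) + f)
    ≤⟨ +-monoˡ-≤ _ (countᵇ-∈ᵇ-unique A (upTo⁺ k)) ⟩
  length A + (χ (not (0 ∈ᵇ A) ∧ inSumset A 0) + f)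
    ≡⟨ cong (λ b → length A + (χ (not b ∧ inSumset A 0) + f)) (Equivalence.to T-≡ 0∈A) ⟩
  length A + f
    ∎
  where
  open ≤-Reasoning
  k = suc k′
  f = countᵇ (newSum A) (applyUpTo suc k′)

length-completions-slots : ∀ g A k′ → T (0 ∈ᵇ A) → T (not (inSumset A (suc k′))) →
                           length (completions (slots A (suc k′)) g) ≤ term g (suc k′) A
length-completions-slots g A k′ 0∈A k∉A+A = begin
  length (completions (slots A (suc k′)) g)
    ≤⟨ length-completions (slots A (suc k′)) g ⟩
  fib (g ∸ (2 + sum (map cost (slots A (suc k′)))))
    ≡⟨ cong (λ c → fib (g ∸ (2 + c))) (total-cost-slots A k′) ⟩
  fib (g ∸ (2 + (k′ + f)))
    ≤⟨ fib-mono (m∸n≤m+o∸p g (2 + (k′ + f)) (length A) (s + suc k′ + 1) counting) ⟩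
  fib (g + length A ∸ (s + suc k′ + 1))
    ≡⟨ term-≡-fib g (suc k′) A ⟨
  term g (suc k′) A
    ∎
  where
  open ≤-Reasoning
  s = sumsetCount A (suc k′)
  f = countᵇ (newSum A) (applyUpTo suc k′)
  regroup : ∀ a f k′ → a + f + suc k′ + 1 ≡ a + (2 + (k′ + f))
  regroup = solve-∀
  counting : s + suc k′ + 1 ≤ length A + (2 + (k′ + f))
  counting = ≤-trans (+-monoˡ-≤ 1 (+-monoˡ-≤ (suc k′) (sumsetCount-≤ A k′ 0∈A k∉A+A)))
                     (≤-reflexive (regroup (length A) f k′))

-- Position 0 of a word stands for the multiplicity itself and always carries ①.
Valid : List Part → Set
Valid w = ∀ i j → (① ∷ w) ‼ i ≡ ① → (① ∷ w) ‼ j ≡ ① → (① ∷ w) ‼ (i + j) ≢ ③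

is① : Decidable (_≡ ①)
is① ① = yes refl
is① ② = no λ ()
is① ③ = no λ ()

is③ : Decidable (_≡ ③)
is③ ① = no λ ()
is③ ② = no λ ()
is③ ③ = yes refl

one-at : ∀ w → Decidable (λ i → (① ∷ w) ‼ i ≡ ①)
one-at w i = is① ((① ∷ w) ‼ i)

onePositions : List Part → ℕ → List ℕ
onePositions w k = filter (one-at w) (upTo k)

∈-onePositions⁺ : ∀ w {k i} → i < k → (① ∷ w) ‼ i ≡ ① → i ∈ onePositions w k
∈-onePositions⁺ w i<k is-① = ∈-filter⁺ (one-at w) (∈-upTo⁺ i<k) is-①

∈-onePositions⁻ : ∀ w {k i} → i ∈ onePositions w k → (① ∷ w) ‼ i ≡ ①
∈-onePositions⁻ w {k} i∈A = proj₂ (∈-filter⁻ (one-at w) {xs = upTo k} i∈A)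

sumset-onePositions : ∀ {w} → Valid w → ∀ k i → T (inSumset (onePositions w k) i) → (① ∷ w) ‼ i ≢ ③
sumset-onePositions {w} valid k i t with inSumset⁻ (onePositions w k) i t
... | a , b , a∈A , b∈A , refl = valid a b (∈-onePositions⁻ w {k} a∈A) (∈-onePositions⁻ w {k} b∈A)

onePositions-∈-𝒜 : ∀ {w} → Valid w → ∀ k′ → (① ∷ w) ‼ suc k′ ≡ ③ →
                   onePositions w (suc k′) ∈ 𝒜 (suc k′)
onePositions-∈-𝒜 {w} valid k′ ③-at-k =
  ∈-filter⁺ (T? ∘ _) (filter-∈-powerset (one-at w) (upTo (suc k′)))
            (Equivalence.from T-∧ (0∈A , k∉A+A))
  where
  A = onePositions w (suc k′)
  0∈A : T (0 ∈ᵇ A)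
  0∈A = ∈⇒∈ᵇ (∈-onePositions⁺ w {suc k′} (s≤s z≤n) refl)
  k∉A+A : T (not (inSumset A (suc k′)))
  k∉A+A = ¬T⇒T-not (λ t → sumset-onePositions valid (suc k′) (suc k′) t ③-at-k)

candidatesWithLast③ : ℕ → ℕ → List (List Part)
candidatesWithLast③ g k = concatMap (λ A → completions (slots A k) g) (𝒜 k)

candidates : ℕ → List (List Part)
candidates g = compositions₁₂ g ++ concatMap (candidatesWithLast③ g) (map suc (upTo (g ∸ 1)))

length-candidates : ∀ g → length (candidates g) ≤ bound g
length-candidates g = begin
  length (candidates g)
    ≡⟨ length-++ (compositions₁₂ g) ⟩
  length (compositions₁₂ g) + length (concatMap (candidatesWithLast③ g) ks)
    ≡⟨ cong₂ _+_ (length-compositions₁₂ g) (length-concatMap (candidatesWithLast③ g) ks) ⟩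
  fib (suc g) + sum (map (length ∘ candidatesWithLast③ g) ks)
    ≤⟨ +-monoʳ-≤ (fib (suc g)) (sum-map-mono per-k) ⟩
  bound g ∎
  where
  open ≤-Reasoning
  ks = map suc (upTo (g ∸ 1))
  per-A : ∀ {k′ A} → A ∈ 𝒜 (suc k′) → length (completions (slots A (suc k′)) g) ≤ term g (suc k′) A
  per-A {k′} {A} A∈𝒜
    with 0∈A , k∉A+A ← Equivalence.to T-∧ (proj₂ (∈-filter⁻ (T? ∘ _) {xs = powerset (upTo (suc k′))} A∈𝒜))
    = length-completions-slots g A k′ 0∈A k∉A+A
  per-k : ∀ {k} → k ∈ ks → length (candidatesWithLast③ g k) ≤ sum (map (term g k) (𝒜 k))
  per-k k∈ks with ∈-map⁻ suc k∈ks
  ... | k′ , _ , refl =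
    ≤-trans (≤-reflexive (length-concatMap _ (𝒜 (suc k′)))) (sum-map-mono {xs = 𝒜 (suc k′)} per-A)

∈-candidatesWithLast③ : ∀ p c → Valid (p ++ ③ ∷ c) → All (_≢ ③) c →
                        p ++ ③ ∷ c ∈ candidatesWithLast③ (total (p ++ ③ ∷ c)) (suc (length p))
∈-candidatesWithLast③ p c valid no③ =
  ∈-concat⁺′ (∈-completions (pointwise-‼ (slot A) suc p fits-at) c no③) (∈-map⁺ _ A∈𝒜)
  where
  w = p ++ ③ ∷ c
  k′ = length p
  A = onePositions w (suc k′)
  A∈𝒜 : A ∈ 𝒜 (suc k′)
  A∈𝒜 = onePositions-∈-𝒜 valid k′ (‼-length p)
  fits-at : ∀ j → j < k′ → p ‼ j fits slot A (suc j)
  fits-at j j<k′ =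
    subst (λ d → d fits slot A (suc j)) (‼-++ˡ p j j<k′) (fits-slot A (suc j) (w ‼ j) ①⇒∈ ∈⇒① ③⇒∉)
    where
    ①⇒∈ : w ‼ j ≡ ① → T (suc j ∈ᵇ A)
    ①⇒∈ is-① = ∈⇒∈ᵇ (∈-onePositions⁺ w {suc k′} (s≤s j<k′) is-①)
    ∈⇒① : T (suc j ∈ᵇ A) → w ‼ j ≡ ①
    ∈⇒① t = ∈-onePositions⁻ w {suc k′} {suc j} (∈ᵇ⇒∈ t)
    ③⇒∉ : w ‼ j ≡ ③ → ¬ T (inSumset A (suc j))
    ③⇒∉ is-③ t = sumset-onePositions valid (suc k′) (suc j) t is-③

∈-candidates : ∀ w → Valid w → w ∈ candidates (total w)
∈-candidates w valid with split-last③ w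
... | inj₁ no③ = ∈-++⁺ˡ (∈-compositions₁₂ w no③)
... | inj₂ (p , c , refl , no③) =
  ∈-++⁺ʳ (compositions₁₂ g)
         (∈-concat⁺′ (∈-candidatesWithLast③ p c valid no③) (∈-map⁺ _ (∈-map⁺ suc (∈-upTo⁺ k′<g∸1))))
  where
  k′ = length p
  g = total (p ++ ③ ∷ c)
  3+k′≤g : 3 + k′ ≤ g
  3+k′≤g = begin
    3 + k′                   ≡⟨ +-comm 3 k′ ⟩
    k′ + 3                   ≤⟨ +-mono-≤ (length≤total p) (m≤m+n 3 (total c)) ⟩
    total p + total (③ ∷ c)  ≡⟨ total-++ p (③ ∷ c) ⟨
    g                        ∎
    where open ≤-Reasoning
  k′<g∸1 : k′ < g ∸ 1
  k′<g∸1 = ≤-trans (n≤1+n (suc k′)) (∸-monoˡ-≤ 1 3+k′≤g)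

-- f < 3m says that Λ has depth ⌈(f + 1)/m⌉ at most 3.
record Depth≤3 (Λ : ℕ → Bool) (m : ℕ) : Set where
  field
    has-zero : Λ 0 ≡ true
    closed   : ∀ a b → Λ a ≡ true → Λ b ≡ true → Λ (a + b) ≡ true
    below-m  : ∀ k → 0 < k → k < m → Λ k ≡ false
    has-m    : Λ m ≡ true
    from-3m  : ∀ n → 3 * m ≤ n → Λ n ≡ true

counted⇒depth≤3 : ∀ {g Λ} → CountedBy-t g Λ → ∃[ m′ ] Depth≤3 Λ (suc m′)
counted⇒depth≤3 (semigroup , _ , suc m′ , f , (_ , has-m , below-m) , (_ , above-f) , f<3m) = m′ , record
  { has-zero = IsNumericalSemigroup.has-zero semigroup
  ; closed   = IsNumericalSemigroup.closed semigroup
  ; below-m  = below-m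
  ; has-m    = has-m
  ; from-3m  = λ n 3m≤n → above-f n (<-≤-trans f<3m 3m≤n)
  }

letter : (ℕ → Bool) → ℕ → ℕ → Part
letter Λ m i = if Λ (m + i) then ① else if Λ (m + (m + i)) then ② else ③

code : (ℕ → Bool) → ℕ → List Part
code Λ m = map (letter Λ m) (applyUpTo suc (m ∸ 1))

length-code : ∀ Λ m′ → length (code Λ (suc m′)) ≡ m′
length-code Λ m′ = trans (length-map (letter Λ (suc m′)) (applyUpTo suc m′)) (length-applyUpTo suc m′)

-- Writing n = q m + r with r < m, the code determines whether n ∈ Λ from layer q at position r.
layer : List Part → ℕ → ℕ → Bool
layer w zero i = i ≡ᵇ 0
layer w (suc zero) i = ⌊ is① ((① ∷ w) ‼ i) ⌋
layer w (suc (suc zero)) i = not ⌊ is③ ((① ∷ w) ‼ i) ⌋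
layer w (suc (suc (suc _))) i = true

decode : List Part → ℕ → Bool
decode w n = layer w (n / suc (length w)) (n % suc (length w))

module Code {Λ : ℕ → Bool} {m′ : ℕ} (depth : Depth≤3 Λ (suc m′)) where
  open Depth≤3 depth

  private
    m = suc m′

  up : ∀ i → Λ (m + i) ≡ true → Λ (m + (m + i)) ≡ true
  up i = closed m (m + i) has-m

  at-code : ∀ {i} → i < m → (① ∷ code Λ m) ‼ i ≡ letter Λ m i
  at-code {zero} _ rewrite +-identityʳ m | has-m = refl
  at-code {suc i} (s≤s i<m′) = map-applyUpTo-‼ (letter Λ m) suc i<m′

  at-code-≥ : ∀ {i} → m ≤ i → (① ∷ code Λ m) ‼ i ≡ ②
  at-code-≥ {suc i} (s≤s m′≤i) = map-applyUpTo-‼-≥ (letter Λ m) suc m′≤i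

  is①-letter : ∀ i → ⌊ is① (letter Λ m i) ⌋ ≡ Λ (m + i)
  is①-letter i with Λ (m + i) | Λ (m + (m + i))
  ... | true | _ = refl
  ... | false | true = refl
  ... | false | false = refl

  is③-letter : ∀ i → not ⌊ is③ (letter Λ m i) ⌋ ≡ Λ (m + (m + i))
  is③-letter i with Λ (m + i) in in₁ | Λ (m + (m + i)) in in₂
  ... | true | true = refl
  ... | true | false = contradiction (trans (sym (up i in₁)) in₂) λ ()
  ... | false | true = refl
  ... | false | false = refl

  ①-at-code : ∀ {i} → i < m → (① ∷ code Λ m) ‼ i ≡ ① → Λ (m + i) ≡ true
  ①-at-code {i} i<m is-① =
    trans (sym (is①-letter i)) (cong (λ d → ⌊ is① d ⌋) (trans (sym (at-code i<m)) is-①))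

  ③-at-code : ∀ {i} → i < m → (① ∷ code Λ m) ‼ i ≡ ③ → Λ (m + (m + i)) ≡ false
  ③-at-code {i} i<m is-③ =
    trans (sym (is③-letter i)) (cong (λ d → not ⌊ is③ d ⌋) (trans (sym (at-code i<m)) is-③))

  code-valid : Valid (code Λ m)
  code-valid i j ①ᵢ ①ⱼ ③ᵢ₊ⱼ with m ≤? i + j
  ... | yes m≤i+j = contradiction (trans (sym (at-code-≥ m≤i+j)) ③ᵢ₊ⱼ) λ ()
  ... | no m≰i+j = contradiction (trans (sym i+j-in) (③-at-code i+j<m ③ᵢ₊ⱼ)) λ ()
    where
    i+j<m = ≰⇒> m≰i+j
    regroup : ∀ m i j → m + i + (m + j) ≡ m + (m + (i + j))
    regroup = solve-∀
    i+j-in : Λ (m + (m + (i + j))) ≡ true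
    i+j-in = subst (λ n → Λ n ≡ true) (regroup m i j)
               (closed (m + i) (m + j) (①-at-code (≤-<-trans (m≤m+n i j) i+j<m) ①ᵢ)
                                       (①-at-code (≤-<-trans (m≤n+m j i) i+j<m) ①ⱼ))

  layer-code : ∀ q {r} → r < m → layer (code Λ m) q r ≡ Λ (r + q * m)
  layer-code zero {zero} _ = sym has-zero
  layer-code zero {suc r} r<m rewrite +-identityʳ r = sym (below-m (suc r) (s≤s z≤n) r<m)
  layer-code (suc zero) {r} r<m = begin
    ⌊ is① ((① ∷ code Λ m) ‼ r) ⌋  ≡⟨ cong (λ d → ⌊ is① d ⌋) (at-code r<m) ⟩
    ⌊ is① (letter Λ m r) ⌋        ≡⟨ is①-letter r ⟩
    Λ (m + r)                     ≡⟨ cong Λ (regroup m r) ⟩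
    Λ (r + 1 * m)                 ∎
    where
    open ≡-Reasoning
    regroup : ∀ m r → m + r ≡ r + 1 * m
    regroup = solve-∀
  layer-code (suc (suc zero)) {r} r<m = begin
    not ⌊ is③ ((① ∷ code Λ m) ‼ r) ⌋  ≡⟨ cong (λ d → not ⌊ is③ d ⌋) (at-code r<m) ⟩
    not ⌊ is③ (letter Λ m r) ⌋        ≡⟨ is③-letter r ⟩
    Λ (m + (m + r))                   ≡⟨ cong Λ (regroup m r) ⟩
    Λ (r + 2 * m)                     ∎
    where
    open ≡-Reasoning
    regroup : ∀ m r → m + (m + r) ≡ r + 2 * m
    regroup = solve-∀
  layer-code q@(suc (suc (suc _))) {r} _ = sym (from-3m (r + q * m) (≤-trans 3m≤qm (m≤n+m (q * m) r)))
    where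
    3m≤qm : 3 * m ≤ q * m
    3m≤qm = *-monoˡ-≤ m {3} {q} (s≤s (s≤s (s≤s z≤n)))

  decode-code : ∀ n → decode (code Λ m) n ≡ Λ n
  decode-code n rewrite length-code Λ m′ =
    trans (layer-code (n / m) (m%n<n n m)) (cong Λ (sym (m≡m%n+[m/n]*n n m)))

  gap : ℕ → Bool
  gap n = not (Λ n)

  gaps₀ gaps₁ gaps₂ gapsAt : ℕ → ℕ
  gaps₀ i = χ (gap i)
  gaps₁ i = χ (gap (m + i))
  gaps₂ i = χ (gap (m + (m + i)))
  gapsAt i = gaps₀ i + (gaps₁ i + gaps₂ i)

  gapsAt-0 : gapsAt 0 ≡ 0
  gapsAt-0 rewrite has-zero | +-identityʳ m | has-m | closed m m has-m has-m = refl

  value-letter : ∀ {i} → i < m′ → value (letter Λ m (suc i)) ≡ gapsAt (suc i)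
  value-letter {i} i<m′ rewrite below-m (suc i) (s≤s z≤n) (s≤s i<m′)
    with Λ (m + suc i) in in₁ | Λ (m + (m + suc i)) in in₂
  ... | true | true = refl
  ... | true | false = contradiction (trans (sym (up (suc i) in₁)) in₂) λ ()
  ... | false | true = refl
  ... | false | false = refl

  countᵇ-gap : countᵇ gap (upTo (3 * m)) ≡ total (code Λ m)
  countᵇ-gap = begin
    countᵇ gap (upTo (3 * m))
      ≡⟨ cong (λ n → sum (map gaps₀ (upTo (m + (m + n))))) (+-identityʳ m) ⟩
    sum (map gaps₀ (upTo (m + (m + m))))
      ≡⟨ cong sum (map-upTo gaps₀ (m + (m + m))) ⟩
    sum (applyUpTo gaps₀ (m + (m + m)))
      ≡⟨ sum-applyUpTo-+ gaps₀ m (m + m) ⟩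
    sum (applyUpTo gaps₀ m) + sum (applyUpTo gaps₁ (m + m))
      ≡⟨ cong (sum (applyUpTo gaps₀ m) +_) (sum-applyUpTo-+ gaps₁ m m) ⟩
    sum (applyUpTo gaps₀ m) + (sum (applyUpTo gaps₁ m) + sum (applyUpTo gaps₂ m))
      ≡⟨ trans (sum-applyUpTo-+ᶠ gaps₀ (λ i → gaps₁ i + gaps₂ i) m)
               (cong (sum (applyUpTo gaps₀ m) +_) (sum-applyUpTo-+ᶠ gaps₁ gaps₂ m)) ⟨
    gapsAt 0 + sum (applyUpTo (gapsAt ∘ suc) m′)
      ≡⟨ cong₂ _+_ gapsAt-0 (sum-applyUpTo-cong m′ (sym ∘ value-letter)) ⟩
    sum (applyUpTo (value ∘ letter Λ m ∘ suc) m′)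
      ≡⟨ cong sum (trans (sym (map-applyUpTo suc (value ∘ letter Λ m) m′)) (map-∘ (applyUpTo suc m′))) ⟩
    total (code Λ m) ∎
    where open ≡-Reasoning

  total-code : ∀ {g} → HasGenus Λ g → total (code Λ m) ≡ g
  total-code {g} (gaps , unique , gaps-are-gaps , length≡g) = begin
    total (code Λ m)                     ≡⟨ countᵇ-gap ⟨
    countᵇ gap (upTo (3 * m))            ≡⟨ length-filterᵇ gap (upTo (3 * m)) ⟨
    length (filterᵇ gap (upTo (3 * m)))  ≡⟨ unique-⇔-length (filter⁺ (T? ∘ gap) (upTo⁺ _)) unique (mk⇔ from to) ⟩
    length gaps                          ≡⟨ length≡g ⟩
    g                                    ∎
    where
    open ≡-Reasoning
    to : ∀ {n} → n ∈ gaps → n ∈ filterᵇ gap (upTo (3 * m))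
    to {n} n∈gaps = ∈-filter⁺ (T? ∘ gap) (∈-upTo⁺ (≰⇒> 3m≰n)) (Equivalence.from T-not-≡ n∉Λ)
      where
      n∉Λ = Equivalence.to (gaps-are-gaps n) n∈gaps
      3m≰n : 3 * m ≰ n
      3m≰n 3m≤n = contradiction (trans (sym (from-3m n 3m≤n)) n∉Λ) λ ()
    from : ∀ {n} → n ∈ filterᵇ gap (upTo (3 * m)) → n ∈ gaps
    from {n} n∈ = Equivalence.from (gaps-are-gaps n)
                    (Equivalence.to T-not-≡ (proj₂ (∈-filter⁻ (T? ∘ gap) {xs = upTo (3 * m)} n∈)))

code-injective : ∀ {Λ Λ′ a b} → Depth≤3 Λ (suc a) → Depth≤3 Λ′ (suc b) →
                 code Λ (suc a) ≡ code Λ′ (suc b) → ∀ n → Λ n ≡ Λ′ n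
code-injective {Λ} {Λ′} depth depth′ same-code n =
  begin
    Λ n                    ≡⟨ Code.decode-code depth n ⟨
    decode (code Λ _) n    ≡⟨ cong (λ w → decode w n) same-code ⟩
    decode (code Λ′ _) n   ≡⟨ Code.decode-code depth′ n ⟩
    Λ′ n                   ∎
  where open ≡-Reasoning

lemma3p9 : ∀ (g : ℕ) → 1 ≤ g → t-AtMost g (bound g)
lemma3p9 g _ k Λs counted distinct = begin
  k                      ≤⟨ distinct-∈⇒≤-length word word-∈ distinct-words ⟩
  length (candidates g)  ≤⟨ length-candidates g ⟩
  bound g                ∎
  where
  open ≤-Reasoning
  m′ : Fin k → ℕ
  m′ i = proj₁ (counted⇒depth≤3 (counted i))
  depth : ∀ i → Depth≤3 (Λs i) (suc (m′ i))
  depth i = proj₂ (counted⇒depth≤3 (counted i))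
  word : Fin k → List Part
  word i = code (Λs i) (suc (m′ i))
  word-∈ : ∀ i → word i ∈ candidates g
  word-∈ i = subst (λ n → word i ∈ candidates n)
                   (Code.total-code (depth i) (proj₁ (proj₂ (counted i))))
                   (∈-candidates (word i) (Code.code-valid (depth i)))
  distinct-words : ∀ i j → i ≢ j → word i ≢ word j
  distinct-words i j i≢j = distinct i j i≢j ∘′ code-injective (depth i) (depth j)
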